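{- Let $k_+\ge k_-\ge0$ be integers and $M=[-k_-,k_+]^*$. Let $G=G_1\times G_2$ be a finite Abelian group and $S=(s_1,\dots,s_n)\in G^n$ with $G=M\diamond_2 S$. Let $\pi:G\to G_1$ be the natural projection and $S_1=\{s_i : \pi(s_i)\ne 0\}$. Then $$|S_1|> n\left(1-\frac{1}{\sqrt{|G_1|}}\right)-1.$$
   Context: $[a,b]^*=\{a,\dots,b\}\setminus\{0\}$. For a finite Abelian group $G$, finite $M\subseteq\mathbb{Z}\setminus\{0\}$, $t\ge1$ and $S=(s_1,\dots,s_n)\in G^n$: $G\ge M\diamond_t S$ means the elements $\sum_i e_is_i$, for $\mathbf{e}\in(M\cup\{0\})^n$ with $1\le\mathrm{wt}(\mathbf{e})\le t$ (Hamming weight), are nonzero and pairwise distinct for distinct $\mathbf{e}$; $G\le M\diamond_t S$ means every $g\in G$ equals $\sum_ie_is_i$ for some $\mathbf{e}\in(M\cup\{0\})^n$ with $\mathrm{wt}(\mathbf{e})\le t$; $G=M\diamond_t S$ means both. -}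

module Defs where

open import Level using (Level; _⊔_)
open import Algebra.Bundles using (AbelianGroup)
open import Data.Nat using (ℕ; zero; suc; _≤_)
open import Data.Integer as ℤ using (ℤ; +_; -[1+_])
open import Data.Fin using (Fin; zero; suc)
open import Data.List using (List; length)
open import Data.List.Relation.Unary.Any using (Any)
open import Data.List.Relation.Unary.AllPairs using (AllPairs)
open import Relation.Nullary using (¬_; Dec; yes; no)
open import Relation.Binary.Definitions using (Decidable)
open import Relation.Binary.PropositionalEquality using (_≡_; _≢_)
open import Data.Product using (Σ; _×_; _,_)

record FiniteAbelianGroup (c ℓ : Level) : Set (Level.suc (c ⊔ ℓ)) where
  field
    group    : AbelianGroup c ℓ
  open AbelianGroup group public hiding (group)
  field
    _≟_      : Decidable _≈_
    elems    : List Carrier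
    complete : ∀ x → Any (x ≈_) elems
    distinct : AllPairs (λ x y → ¬ (x ≈ y)) elems

  card : ℕ
  card = length elems

count : ∀ {p} {n : ℕ} {P : Fin n → Set p} → (∀ i → Dec (P i)) → ℕ
count {n = zero}  d = 0
count {n = suc n} d with d zero
... | yes _ = suc (count (λ i → d (suc i)))
... | no  _ = count (λ i → d (suc i))

wt : ∀ {n} → (Fin n → ℤ) → ℕ
wt e = count (λ i → ¬? (e i ℤ.≟ + 0))
  where open import Relation.Nullary.Decidable using (¬?)

-- e ∈ M ∪ {0} for M = [-k₋, k₊]^*, i.e. -k₋ ≤ e ≤ k₊
InM₀ : ℕ → ℕ → ℤ → Set
InM₀ k₋ k₊ e = (ℤ.- (+ k₋)) ℤ.≤ e × e ℤ.≤ (+ k₊)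

module _ {a ℓ} (G : AbelianGroup a ℓ) where
  open AbelianGroup G

  ℕmul : ℕ → Carrier → Carrier
  ℕmul zero    x = ε
  ℕmul (suc k) x = x ∙ ℕmul k x

  ℤmul : ℤ → Carrier → Carrier
  ℤmul (+ k)      x = ℕmul k x
  ℤmul -[1+ k ]   x = (ℕmul (suc k) x) ⁻¹

  sumFin : ∀ {n} → (Fin n → Carrier) → Carrier
  sumFin {zero}  f = ε
  sumFin {suc n} f = f zero ∙ sumFin (λ i → f (suc i))

  lin : ∀ {n} → (Fin n → ℤ) → (Fin n → Carrier) → Carrier
  lin e s = sumFin (λ i → ℤmul (e i) (s i))

  Adm : ℕ → ℕ → ∀ {n} → (Fin n → ℤ) → Set
  Adm k₋ k₊ e = ∀ i → InM₀ k₋ k₊ (e i)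

  Packing : ℕ → ℕ → ℕ → ∀ {n} → (Fin n → Carrier) → Set ℓ
  Packing k₋ k₊ t {n} s =
    ∀ (e e' : Fin n → ℤ) → Adm k₋ k₊ e → Adm k₋ k₊ e' →
      1 ≤ wt e → wt e ≤ t → 1 ≤ wt e' → wt e' ≤ t →
      ¬ (lin e s ≈ ε) × (lin e s ≈ lin e' s → ∀ i → e i ≡ e' i)

  Covering : ℕ → ℕ → ℕ → ∀ {n} → (Fin n → Carrier) → Set (a ⊔ ℓ)
  Covering k₋ k₊ t {n} s =
    ∀ (g : Carrier) → Σ (Fin n → ℤ) λ e → Adm k₋ k₊ e × wt e ≤ t × lin e s ≈ g

  Perfect : ℕ → ℕ → ℕ → ∀ {n} → (Fin n → Carrier) → Set (a ⊔ ℓ)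
  Perfect k₋ k₊ t s = Packing k₋ k₊ t s × Covering k₋ k₊ t s

-- Let m be the number of sᵢ in the kernel of π, K = k₋ + k₊, and V(m) = 1 + mK + C(m,2)K² the
-- number of coefficient vectors of weight ≤ 2 on m coordinates.  For x ∈ G₁ and such a vector e
-- supported on the kernel coordinates, the elements (x, 0) + Σ eᵢsᵢ are pairwise distinct: π
-- recovers x, and the packing property then recovers e.  The covering property assigns to each of
-- these |G₁| V(m) elements its own coefficient vector of weight ≤ 2 on all n coordinates, so
-- |G₁| V(m) ≤ V(n).  If m ≥ 1, comparing the closed forms term by term gives V(n) (m − 1)² < V(m) n²,
-- i.e. |G₁| (n − |S₁| − 1)² < n².
module Submission where

open import Defs
open import Level using (Level; 0ℓ)
open import Data.Nat using (ℕ; zero; suc; _≤_; _<_; _+_; _*_; _∸_; _^_; s≤s; z≤n)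
open import Data.Nat.Properties
open import Data.Nat.Tactic.RingSolver using (solve)
open import Data.Integer as ℤ using (ℤ; +_; -[1+_]; 0ℤ; -≤+; +≤+)
open import Data.Integer.Properties
  using (neg-≤-pos; neg-mono-≤; neg-cancel-≤; drop‿+≤+; +-injective; -[1+-injective)
open import Data.Fin using (Fin; zero; suc)
open import Data.Vec.Functional using (Vector; head; tail) renaming (_∷_ to _∷ᵥ_)
open import Data.Vec.Functional.Properties using (∷-cong; ∷-injective)
open import Data.Bool using (true; false; if_then_else_)
open import Data.List using (List; []; _∷_; [_]; length; map; _++_; applyUpTo; cartesianProductWith)
open import Data.List.Properties using (length-++; length-map; length-applyUpTo; length-removeAt′)
open import Data.List.Membership.Propositional using (_∈_; _∉_)
open import Data.List.Membership.Propositional.Properties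
  using (∈-applyUpTo⁺; ∈-applyUpTo⁻; ∈-++⁺ˡ; ∈-++⁺ʳ; ∈-++⁻)
import Data.List.Membership.Setoid as Membership
import Data.List.Membership.Setoid.Properties as Membershipₚ
open import Data.List.Relation.Unary.All as All using (All; [])
import Data.List.Relation.Unary.All.Properties as All
open import Data.List.Relation.Unary.Any using (here; there; index; _─_)
open import Data.List.Relation.Unary.AllPairs as AllPairs using ([])
import Data.List.Relation.Unary.Unique.Propositional as Propositional
import Data.List.Relation.Unary.Unique.Propositional.Properties as Propositional
open import Data.List.Relation.Unary.Unique.Setoid using (Unique)
import Data.List.Relation.Unary.Unique.Setoid.Properties as Unique
open import Data.Product using (Σ; _×_; _,_; proj₁; proj₂)
open import Data.Sum as Sum using (_⊎_; inj₁; inj₂)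
open import Data.Unit using (⊤; tt)
open import Function using (_∘_)
open import Algebra.Bundles using (AbelianGroup)
open import Algebra.Construct.DirectProduct using (abelianGroup)
import Algebra.Properties.CommutativeSemigroup as CommutativeSemigroupProperties
import Algebra.Properties.Group as GroupProperties
open import Relation.Binary.Bundles using (Setoid)
import Relation.Binary.Construct.On as On
open import Relation.Binary.PropositionalEquality as ≡ using (_≡_; _≗_; cong; cong₂; _→-setoid_)
open import Relation.Nullary using (¬_; Dec; yes; no; does; contradiction)
open import Relation.Nullary.Decidable using (¬?)

module _ {c ℓ} (S : Setoid c ℓ) where
  open Setoid S
  open Membership S using () renaming (_∈_ to _∈ₛ_)

  ∈-─ : ∀ {x y ys} (x∈ys : x ∈ₛ ys) → y ∈ₛ ys → ¬ y ≈ x → y ∈ₛ (ys ─ x∈ys)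
  ∈-─ (here x≈z)   (here y≈z)   y≉x = contradiction (trans y≈z (sym x≈z)) y≉x
  ∈-─ (here _)     (there y∈ys) _   = y∈ys
  ∈-─ (there _)    (here y≈z)   _   = here y≈z
  ∈-─ (there x∈ys) (there y∈ys) y≉x = there (∈-─ x∈ys y∈ys y≉x)

  unique⇒length≤ : ∀ {xs ys} → Unique S xs → All (_∈ₛ ys) xs → length xs ≤ length ys
  unique⇒length≤ []                  []                 = z≤n
  unique⇒length≤ {ys = ys} (x≉xs AllPairs.∷ xs!) (x∈ys All.∷ xs⊆ys) = ≤-trans
    (s≤s (unique⇒length≤ xs!
      (All.zipWith (λ (x≉y , y∈ys) → ∈-─ x∈ys y∈ys (x≉y ∘ sym)) (x≉xs , xs⊆ys))))
    (≤-reflexive (≡.sym (length-removeAt′ ys (index x∈ys))))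

map-proj₁-toList : ∀ {a p} {A : Set a} {P : A → Set p} {xs} (pxs : All P xs) → map proj₁ (All.toList pxs) ≡ xs
map-proj₁-toList []             = ≡.refl
map-proj₁-toList (px All.∷ pxs) = cong (_ ∷_) (map-proj₁-toList pxs)

length-cartesianProductWith : ∀ {a b c} {A : Set a} {B : Set b} {C : Set c} (f : A → B → C) xs ys →
  length (cartesianProductWith f xs ys) ≡ length xs * length ys
length-cartesianProductWith f []       ys = ≡.refl
length-cartesianProductWith f (x ∷ xs) ys = ≡.trans (length-++ (map (f x) ys))
  (cong₂ _+_ (length-map (f x) ys) (length-cartesianProductWith f xs ys))

count-complement : ∀ {p n} {P : Fin n → Set p} (P? : ∀ i → Dec (P i)) → count P? + count (¬? ∘ P?) ≡ n
count-complement {n = zero}  P? = ≡.refl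
count-complement {n = suc n} P? with P? zero
... | yes _ = cong suc (count-complement (P? ∘ suc))
... | no _  = ≡.trans (+-suc _ _) (cong suc (count-complement (P? ∘ suc)))

count-all : ∀ {p n} {P : Fin n → Set p} (P? : ∀ i → Dec (P i)) → (∀ i → P i) → count P? ≡ n
count-all {n = zero}  P? _  = ≡.refl
count-all {n = suc n} P? ∀P with P? zero
... | yes _  = cong suc (count-all (P? ∘ suc) (∀P ∘ suc))
... | no ¬P₀ = contradiction (∀P zero) ¬P₀

wt≤suc-wt-tail : ∀ {n} (e : Vector ℤ (suc n)) → wt e ≤ suc (wt (tail e))
wt≤suc-wt-tail e with e zero ℤ.≟ 0ℤ
... | yes _ = n≤1+n _
... | no _  = ≤-refl

wt≡0⇒≗0 : ∀ {n} (e : Vector ℤ n) → wt e ≡ 0 → ∀ i → e i ≡ 0ℤ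
wt≡0⇒≗0 e wt≡0 zero with e zero ℤ.≟ 0ℤ
... | yes e₀≡0 = e₀≡0
wt≡0⇒≗0 e wt≡0 (suc i) with e zero ℤ.≟ 0ℤ
... | yes _ = wt≡0⇒≗0 (tail e) wt≡0 i

-- The number of vectors of length m and weight ≤ t over an alphabet of K nonzero letters and 0.
ballSize : ℕ → ℕ → ℕ → ℕ
ballSize K zero    t       = 1
ballSize K (suc m) zero    = ballSize K m zero
ballSize K (suc m) (suc t) = ballSize K m (suc t) + K * ballSize K m t

ballSize-radius0 : ∀ K m → ballSize K m 0 ≡ 1
ballSize-radius0 K zero    = ≡.refl
ballSize-radius0 K (suc m) = ballSize-radius0 K m

ballSize-radius1 : ∀ K m → ballSize K m 1 ≡ 1 + m * K
ballSize-radius1 K zero    = ≡.refl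
ballSize-radius1 K (suc m) = begin
  ballSize K m 1 + K * ballSize K m 0
    ≡⟨ cong₂ (λ x y → x + K * y) (ballSize-radius1 K m) (ballSize-radius0 K m) ⟩
  1 + m * K + K * 1
    ≡⟨ solve (m ∷ K ∷ []) ⟩
  1 + suc m * K ∎
  where open ≡.≡-Reasoning

ballSize-radius2 : ∀ K p → 2 * ballSize K (suc p) 2 ≡ 2 + 2 * suc p * K + suc p * p * (K * K)
ballSize-radius2 K zero    = begin
  2 * (1 + K * 1)                 ≡⟨ solve (K ∷ []) ⟩
  2 + 2 * 1 * K + 1 * 0 * (K * K) ∎
  where open ≡.≡-Reasoning
ballSize-radius2 K (suc p) = begin
  2 * (ballSize K (suc p) 2 + K * ballSize K (suc p) 1)
    ≡⟨ *-distribˡ-+ 2 (ballSize K (suc p) 2) _ ⟩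
  2 * ballSize K (suc p) 2 + 2 * (K * ballSize K (suc p) 1)
    ≡⟨ cong₂ (λ x y → x + 2 * (K * y)) (ballSize-radius2 K p) (ballSize-radius1 K (suc p)) ⟩
  2 + 2 * suc p * K + suc p * p * (K * K) + 2 * (K * (1 + suc p * K))
    ≡⟨ solve (p ∷ K ∷ []) ⟩
  2 + 2 * suc (suc p) * K + suc (suc p) * suc p * (K * K) ∎
  where open ≡.≡-Reasoning

ballSize-radius2-ratio : ∀ K p r →
  p * p * (2 * ballSize K (suc p + r) 2) < (suc p + r) * (suc p + r) * (2 * ballSize K (suc p) 2)
ballSize-radius2-ratio K p r = begin-strict
  p * p * (2 * ballSize K (suc p + r) 2)
    ≡⟨ cong (p * p *_) (ballSize-radius2 K (p + r)) ⟩
  p * p * (2 + 2 * suc (p + r) * K + suc (p + r) * (p + r) * (K * K))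
    ≡⟨ solve (p ∷ r ∷ K ∷ []) ⟩
  p * p * 2 + p * p * suc (p + r) * (2 * K) + p * suc (p + r) * (p * (p + r)) * (K * K)
    <⟨ +-mono-<-≤ (+-mono-<-≤ constant linear) quadratic ⟩
  suc (p + r) * suc (p + r) * 2 + suc (p + r) * suc p * suc (p + r) * (2 * K)
    + p * suc (p + r) * (suc p * suc (p + r)) * (K * K)
    ≡⟨ solve (p ∷ r ∷ K ∷ []) ⟩
  suc (p + r) * suc (p + r) * (2 + 2 * suc p * K + suc p * p * (K * K))
    ≡⟨ cong (suc (p + r) * suc (p + r) *_) (ballSize-radius2 K p) ⟨
  suc (p + r) * suc (p + r) * (2 * ballSize K (suc p) 2) ∎
  where
  open ≤-Reasoning
  m = suc p
  n = suc p + r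
  p<n : p < n
  p<n = s≤s (m≤m+n p r)
  constant : p * p * 2 < n * n * 2
  constant = *-monoˡ-< 2 (*-mono-< p<n p<n)
  linear : p * p * n * (2 * K) ≤ n * m * n * (2 * K)
  linear = *-monoˡ-≤ (2 * K) (*-monoˡ-≤ n (*-mono-≤ (<⇒≤ p<n) (n≤1+n p)))
  quadratic : p * n * (p * (p + r)) * (K * K) ≤ p * n * (m * n) * (K * K)
  quadratic = *-monoˡ-≤ (K * K) (*-monoʳ-≤ (p * n) (*-mono-≤ (n≤1+n p) (n≤1+n (p + r))))

ballSize-radius2-bound : ∀ K c p r →
  c * ballSize K (suc p) 2 ≤ ballSize K (suc p + r) 2 → p ^ 2 * c < (suc p + r) ^ 2
ballSize-radius2-bound K c p r c*Bm≤Bn =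
  *-cancelʳ-< (2 * ballSize K (suc p) 2) (p ^ 2 * c) ((suc p + r) ^ 2) (begin-strict
  p ^ 2 * c * (2 * ballSize K (suc p) 2)     ≡⟨ *-assoc (p ^ 2) c _ ⟩
  p ^ 2 * (c * (2 * ballSize K (suc p) 2))   ≡⟨ cong (p ^ 2 *_) (x∙yz≈y∙xz c 2 _) ⟩
  p ^ 2 * (2 * (c * ballSize K (suc p) 2))   ≤⟨ *-monoʳ-≤ (p ^ 2) (*-monoʳ-≤ 2 c*Bm≤Bn) ⟩
  p ^ 2 * (2 * ballSize K (suc p + r) 2)     ≡⟨ cong (_* (2 * ballSize K (suc p + r) 2)) (square p) ⟨
  p * p * (2 * ballSize K (suc p + r) 2)     <⟨ ballSize-radius2-ratio K p r ⟩
  (suc p + r) * (suc p + r) * (2 * ballSize K (suc p) 2)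
                                             ≡⟨ cong (_* (2 * ballSize K (suc p) 2)) (square (suc p + r)) ⟩
  (suc p + r) ^ 2 * (2 * ballSize K (suc p) 2) ∎)
  where
  open ≤-Reasoning
  open CommutativeSemigroupProperties *-commutativeSemigroup using (x∙yz≈y∙xz)
  square : ∀ x → x * x ≡ x ^ 2
  square x = cong (x *_) (≡.sym (*-identityʳ x))

ballSize-radius2-bound-∸ : ∀ K c m r n → m + r ≡ n → c * ballSize K m 2 ≤ ballSize K n 2 →
  n ≤ r + 1 ⊎ (n ∸ (r + 1)) ^ 2 * c < n ^ 2
ballSize-radius2-bound-∸ K c zero    r .r           ≡.refl _     = inj₁ (m≤m+n r 1)
ballSize-radius2-bound-∸ K c (suc p) r .(suc p + r) ≡.refl bound
  rewrite +-comm r 1 | m+n∸n≡m p r = inj₂ (ballSize-radius2-bound K c p r bound)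

Vectorₛ : ℕ → Setoid 0ℓ 0ℓ
Vectorₛ n = Fin n →-setoid ℤ

module _ {n : ℕ} where
  open Membership (Vectorₛ n) public using () renaming (_∈_ to _∈ᵥ_)

Entries : ∀ {n} → (Fin n → List ℤ) → Vector ℤ n → Set
Entries C e = ∀ i → e i ≡ 0ℤ ⊎ e i ∈ C i

vectors : ∀ {n} → (Fin n → List ℤ) → ℕ → List (Vector ℤ n)
vectors {zero}  C t       = [ (λ ()) ]
vectors {suc n} C zero    = map (0ℤ ∷ᵥ_) (vectors (tail C) zero)
vectors {suc n} C (suc t) = map (0ℤ ∷ᵥ_) (vectors (tail C) (suc t))
                         ++ cartesianProductWith _∷ᵥ_ (head C) (vectors (tail C) t)

Entries-∷ : ∀ {n} {C : Fin (suc n) → List ℤ} {c v} →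
  c ≡ 0ℤ ⊎ c ∈ head C → Entries (tail C) v → Entries C (c ∷ᵥ v)
Entries-∷ c-ok entries zero    = c-ok
Entries-∷ c-ok entries (suc i) = entries i

0∷-sound : ∀ {n} {C : Fin (suc n) → List ℤ} {t v} →
  Entries (tail C) v × wt v ≤ t → Entries C (0ℤ ∷ᵥ v) × wt (0ℤ ∷ᵥ v) ≤ t
0∷-sound (entries , w) = Entries-∷ (inj₁ ≡.refl) entries , w

vectors-sound : ∀ {n} (C : Fin n → List ℤ) t → All (λ e → Entries C e × wt e ≤ t) (vectors C t)
vectors-sound {zero}  C t       = ((λ ()) , z≤n) All.∷ []
vectors-sound {suc n} C zero    = All.map⁺ (All.map 0∷-sound (vectors-sound (tail C) zero))
vectors-sound {suc n} C (suc t) = All.++⁺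
  (All.map⁺ (All.map 0∷-sound (vectors-sound (tail C) (suc t))))
  (All.cartesianProductWith⁺ (≡.setoid ℤ) (≡.setoid _) _∷ᵥ_ (head C) (vectors (tail C) t) c∷-sound)
  where
  c∷-sound : ∀ {c v} → c ∈ head C → v ∈ vectors (tail C) t →
    Entries C (c ∷ᵥ v) × wt (c ∷ᵥ v) ≤ suc t
  c∷-sound {c} {v} c∈C₀ v∈vs = let entries , w = All.lookup (vectors-sound (tail C) t) v∈vs in
    Entries-∷ (inj₂ c∈C₀) entries , ≤-trans (wt≤suc-wt-tail (c ∷ᵥ v)) (s≤s w)

vectors-unique : ∀ {n} (C : Fin n → List ℤ) → (∀ i → Propositional.Unique (C i)) → (∀ i → 0ℤ ∉ C i) →
  ∀ t → Unique (Vectorₛ n) (vectors C t)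
vectors-unique {zero}  C C! 0∉C t       = [] AllPairs.∷ []
vectors-unique {suc n} C C! 0∉C zero    =
  Unique.map⁺ (Vectorₛ n) (Vectorₛ (suc n)) (_∘ suc) (vectors-unique (tail C) (C! ∘ suc) (0∉C ∘ suc) zero)
vectors-unique {suc n} C C! 0∉C (suc t) = Unique.++⁺ (Vectorₛ (suc n))
  (Unique.map⁺ (Vectorₛ n) (Vectorₛ (suc n)) (_∘ suc) (vectors-unique (tail C) (C! ∘ suc) (0∉C ∘ suc) (suc t)))
  (Unique.cartesianProductWith⁺ (≡.setoid ℤ) (Vectorₛ n) (Vectorₛ (suc n)) _∷ᵥ_ ∷-injective (C! zero)
    (vectors-unique (tail C) (C! ∘ suc) (0∉C ∘ suc) t))
  disjoint
  where
  disjoint : ∀ {e} → ¬ (e ∈ᵥ map (0ℤ ∷ᵥ_) (vectors (tail C) (suc t))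
                      × e ∈ᵥ cartesianProductWith _∷ᵥ_ (head C) (vectors (tail C) t))
  disjoint (e∈0∷ , e∈c∷)
    with _ , _ , e≗0∷ ← Membershipₚ.∈-map⁻ (Vectorₛ n) (Vectorₛ (suc n)) e∈0∷
       | c , _ , c∈C₀ , _ , e≗c∷ ← Membershipₚ.∈-cartesianProductWith⁻ (≡.setoid ℤ) (Vectorₛ n) (Vectorₛ (suc n))
                                     _∷ᵥ_ (head C) _ e∈c∷
    = 0∉C zero (≡.subst (_∈ head C) (≡.trans (≡.sym (e≗c∷ zero)) (e≗0∷ zero)) c∈C₀)

vectors-complete : ∀ {n} (C : Fin n → List ℤ) {t} (e : Vector ℤ n) →
  Entries C e → wt e ≤ t → e ∈ᵥ vectors C t
vectors-complete {zero}  C e entries w = here (λ ())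
vectors-complete {suc n} C {t} e entries w with e zero ℤ.≟ 0ℤ
... | yes e₀≡0 = in-0∷ t (vectors-complete (tail C) (tail e) (entries ∘ suc) w)
  where
  e∈0∷ : ∀ {t} → tail e ∈ᵥ vectors (tail C) t → e ∈ᵥ map (0ℤ ∷ᵥ_) (vectors (tail C) t)
  e∈0∷ = Membershipₚ.∈-resp-≈ (Vectorₛ (suc n)) (∷-cong (≡.sym e₀≡0) (λ _ → ≡.refl))
       ∘ Membershipₚ.∈-map⁺ (Vectorₛ n) (Vectorₛ (suc n)) (∷-cong ≡.refl)
  in-0∷ : ∀ t → tail e ∈ᵥ vectors (tail C) t → e ∈ᵥ vectors C t
  in-0∷ zero    = e∈0∷
  in-0∷ (suc t) = Membershipₚ.∈-++⁺ˡ (Vectorₛ (suc n)) ∘ e∈0∷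
... | no e₀≢0 = in-c∷ t w
  where
  e₀∈C₀ : e zero ∈ head C
  e₀∈C₀ with entries zero
  ... | inj₁ e₀≡0  = contradiction e₀≡0 e₀≢0
  ... | inj₂ e₀∈C₀ = e₀∈C₀
  in-c∷ : ∀ t → suc (wt (tail e)) ≤ t → e ∈ᵥ vectors C t
  in-c∷ (suc t) (s≤s w) = Membershipₚ.∈-++⁺ʳ (Vectorₛ (suc n)) _
    (Membershipₚ.∈-resp-≈ (Vectorₛ (suc n)) (∷-cong ≡.refl (λ _ → ≡.refl))
      (Membershipₚ.∈-cartesianProductWith⁺ (≡.setoid ℤ) (Vectorₛ n) (Vectorₛ (suc n)) ∷-cong e₀∈C₀
        (vectors-complete (tail C) (tail e) (entries ∘ suc) w)))

coefficientsOn : ∀ {p n} {P : Fin n → Set p} → List ℤ → (∀ i → Dec (P i)) → Fin n → List ℤ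
coefficientsOn M P? i = if does (P? i) then M else []

module _ {p n} {P : Fin n → Set p} (M : List ℤ) (P? : ∀ i → Dec (P i)) where

  ∈-coefficientsOn⁻ : ∀ {c i} → c ∈ coefficientsOn M P? i → P i × c ∈ M
  ∈-coefficientsOn⁻ {i = i} with P? i
  ... | yes Pᵢ = Pᵢ ,_
  ... | no _   = λ ()

  coefficientsOn-preserves : ∀ {q} (Q : List ℤ → Set q) → Q M → Q [] → ∀ i → Q (coefficientsOn M P? i)
  coefficientsOn-preserves Q QM Q[] i with does (P? i)
  ... | true  = QM
  ... | false = Q[]

length-vectors-radius0 : ∀ {n} (C : Fin n → List ℤ) → length (vectors C 0) ≡ 1
length-vectors-radius0 {zero}  C = ≡.refl
length-vectors-radius0 {suc n} C =
  ≡.trans (length-map (0ℤ ∷ᵥ_) (vectors (tail C) 0)) (length-vectors-radius0 (tail C))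

length-vectors : ∀ {p n} {P : Fin n → Set p} (M : List ℤ) (P? : ∀ i → Dec (P i)) t →
  length (vectors (coefficientsOn M P?) t) ≡ ballSize (length M) (count P?) t
length-vectors {n = zero}  M P? t       = ≡.refl
length-vectors {n = suc n} M P? zero    =
  ≡.trans (length-vectors-radius0 (coefficientsOn M P?)) (≡.sym (ballSize-radius0 (length M) (count P?)))
length-vectors {n = suc n} M P? (suc t) = begin
  length (map (0ℤ ∷ᵥ_) (vectors C′ (suc t)) ++ cartesianProductWith _∷ᵥ_ (C zero) (vectors C′ t))
    ≡⟨ length-++ (map (0ℤ ∷ᵥ_) (vectors C′ (suc t))) ⟩
  length (map (0ℤ ∷ᵥ_) (vectors C′ (suc t))) + length (cartesianProductWith _∷ᵥ_ (C zero) (vectors C′ t))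
    ≡⟨ cong₂ _+_ (length-map (0ℤ ∷ᵥ_) (vectors C′ (suc t)))
                 (length-cartesianProductWith _∷ᵥ_ (C zero) (vectors C′ t)) ⟩
  length (vectors C′ (suc t)) + length (C zero) * length (vectors C′ t)
    ≡⟨ cong₂ (λ x y → x + length (C zero) * y)
             (length-vectors M (P? ∘ suc) (suc t)) (length-vectors M (P? ∘ suc) t) ⟩
  ballSize K (count (P? ∘ suc)) (suc t) + length (C zero) * ballSize K (count (P? ∘ suc)) t
    ≡⟨ head-step ⟩
  ballSize K (count P?) (suc t) ∎
  where
  open ≡.≡-Reasoning
  K = length M
  C = coefficientsOn M P?
  C′ = coefficientsOn M (P? ∘ suc)
  head-step : ballSize K (count (P? ∘ suc)) (suc t) + length (C zero) * ballSize K (count (P? ∘ suc)) t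
            ≡ ballSize K (count P?) (suc t)
  head-step with P? zero
  ... | yes _ = ≡.refl
  ... | no _  = +-identityʳ _

nonzeroRange : ℕ → ℕ → List ℤ
nonzeroRange k₋ k₊ = applyUpTo -[1+_] k₋ ++ applyUpTo (+_ ∘ suc) k₊

module _ (k₋ k₊ : ℕ) where

  length-nonzeroRange : length (nonzeroRange k₋ k₊) ≡ k₋ + k₊
  length-nonzeroRange = ≡.trans (length-++ (applyUpTo -[1+_] k₋))
    (cong₂ _+_ (length-applyUpTo -[1+_] k₋) (length-applyUpTo (+_ ∘ suc) k₊))

  nonzeroRange-unique : Propositional.Unique (nonzeroRange k₋ k₊)
  nonzeroRange-unique = Propositional.++⁺
    (Propositional.applyUpTo⁺₁ -[1+_] k₋ (λ i<j _ → <⇒≢ i<j ∘ -[1+-injective))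
    (Propositional.applyUpTo⁺₁ (+_ ∘ suc) k₊ (λ i<j _ → <⇒≢ (s≤s i<j) ∘ +-injective))
    negative≢positive
    where
    negative≢positive : ∀ {c} → ¬ (c ∈ applyUpTo -[1+_] k₋ × c ∈ applyUpTo (+_ ∘ suc) k₊)
    negative≢positive (c∈negs , c∈poss)
      with _ , _ , ≡.refl ← ∈-applyUpTo⁻ -[1+_] c∈negs
      with _ , _ , () ← ∈-applyUpTo⁻ (+_ ∘ suc) c∈poss

  0∉nonzeroRange : 0ℤ ∉ nonzeroRange k₋ k₊
  0∉nonzeroRange 0∈ with ∈-++⁻ (applyUpTo -[1+_] k₋) 0∈
  ... | inj₁ 0∈negs with _ , _ , () ← ∈-applyUpTo⁻ -[1+_] 0∈negs
  ... | inj₂ 0∈poss with _ , _ , () ← ∈-applyUpTo⁻ (+_ ∘ suc) 0∈poss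

  InM₀⇒0⊎∈nonzeroRange : ∀ {c} → InM₀ k₋ k₊ c → c ≡ 0ℤ ⊎ c ∈ nonzeroRange k₋ k₊
  InM₀⇒0⊎∈nonzeroRange {+ zero}    _              = inj₁ ≡.refl
  InM₀⇒0⊎∈nonzeroRange {+ suc i}   (_ , +≤+ i<k₊) =
    inj₂ (∈-++⁺ʳ (applyUpTo -[1+_] k₋) (∈-applyUpTo⁺ (+_ ∘ suc) i<k₊))
  InM₀⇒0⊎∈nonzeroRange { -[1+ i ]} (-k₋≤c , _)    =
    inj₂ (∈-++⁺ˡ (∈-applyUpTo⁺ -[1+_] (drop‿+≤+ (neg-cancel-≤ -k₋≤c))))

  0⊎∈nonzeroRange⇒InM₀ : ∀ {c} → c ≡ 0ℤ ⊎ c ∈ nonzeroRange k₋ k₊ → InM₀ k₋ k₊ c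
  0⊎∈nonzeroRange⇒InM₀ (inj₁ ≡.refl) = neg-≤-pos , +≤+ z≤n
  0⊎∈nonzeroRange⇒InM₀ (inj₂ c∈) with ∈-++⁻ (applyUpTo -[1+_] k₋) c∈
  ... | inj₁ c∈negs with _ , i<k₋ , ≡.refl ← ∈-applyUpTo⁻ -[1+_] c∈negs = neg-mono-≤ (+≤+ i<k₋) , -≤+
  ... | inj₂ c∈poss with _ , i<k₊ , ≡.refl ← ∈-applyUpTo⁻ (+_ ∘ suc) c∈poss = neg-≤-pos , +≤+ i<k₊

module _ {a ℓ} (G : AbelianGroup a ℓ) where
  open AbelianGroup G
  open GroupProperties group using (ε⁻¹≈ε)

  ℕmul-ε : ∀ k {x} → x ≈ ε → ℕmul G k x ≈ ε
  ℕmul-ε zero    x≈ε = refl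
  ℕmul-ε (suc k) x≈ε = trans (∙-cong x≈ε (ℕmul-ε k x≈ε)) (identityˡ ε)

  ℤmul-ε : ∀ c {x} → x ≈ ε → ℤmul G c x ≈ ε
  ℤmul-ε (+ k)    x≈ε = ℕmul-ε k x≈ε
  ℤmul-ε -[1+ k ] x≈ε = trans (⁻¹-cong (ℕmul-ε (suc k) x≈ε)) ε⁻¹≈ε

  sumFin-cong : ∀ {n} {f g : Fin n → Carrier} → (∀ i → f i ≈ g i) → sumFin G f ≈ sumFin G g
  sumFin-cong {zero}  f≈g = refl
  sumFin-cong {suc n} f≈g = ∙-cong (f≈g zero) (sumFin-cong (f≈g ∘ suc))

  sumFin-ε : ∀ {n} {f : Fin n → Carrier} → (∀ i → f i ≈ ε) → sumFin G f ≈ ε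
  sumFin-ε {zero}  f≈ε = refl
  sumFin-ε {suc n} f≈ε = trans (∙-cong (f≈ε zero) (sumFin-ε (f≈ε ∘ suc))) (identityˡ ε)

  lin-cong : ∀ {n} {e e' : Fin n → ℤ} (s : Fin n → Carrier) → e ≗ e' → lin G e s ≈ lin G e' s
  lin-cong s e≗e' = sumFin-cong (λ i → reflexive (cong (λ c → ℤmul G c (s i)) (e≗e' i)))

  lin-ε : ∀ {n} {e : Fin n → ℤ} {s : Fin n → Carrier} →
    (∀ i → e i ≡ 0ℤ ⊎ s i ≈ ε) → lin G e s ≈ ε
  lin-ε {e = e} {s} vanishes = sumFin-ε term-ε
    where
    term-ε : ∀ i → ℤmul G (e i) (s i) ≈ ε
    term-ε i with vanishes i
    ... | inj₁ eᵢ≡0 = reflexive (cong (λ c → ℤmul G c (s i)) eᵢ≡0)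
    ... | inj₂ sᵢ≈ε = ℤmul-ε (e i) sᵢ≈ε

  lin-injective : ∀ {k₋ k₊ t n} {s : Fin n → Carrier} → Packing G k₋ k₊ t s →
    ∀ {e e'} → Adm G k₋ k₊ e → Adm G k₋ k₊ e' → wt e ≤ t → wt e' ≤ t →
    lin G e s ≈ lin G e' s → e ≗ e'
  lin-injective packing {e} {e'} adm adm' w≤t w'≤t eq with wt e ≟ 0 | wt e' ≟ 0
  ... | yes w≡0 | yes w'≡0 = λ i → ≡.trans (wt≡0⇒≗0 e w≡0 i) (≡.sym (wt≡0⇒≗0 e' w'≡0 i))
  ... | yes w≡0 | no w'≢0  = contradiction (trans (sym eq) (lin-ε (inj₁ ∘ wt≡0⇒≗0 e w≡0)))
                               (proj₁ (packing e' e' adm' adm' (n≢0⇒n>0 w'≢0) w'≤t (n≢0⇒n>0 w'≢0) w'≤t))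
  ... | no w≢0  | yes w'≡0 = contradiction (trans eq (lin-ε (inj₁ ∘ wt≡0⇒≗0 e' w'≡0)))
                               (proj₁ (packing e e adm adm (n≢0⇒n>0 w≢0) w≤t (n≢0⇒n>0 w≢0) w≤t))
  ... | no w≢0  | no w'≢0  = proj₂ (packing e e' adm adm' (n≢0⇒n>0 w≢0) w≤t (n≢0⇒n>0 w'≢0) w'≤t) eq

module _ {a b ℓa ℓb} (G : AbelianGroup a ℓa) (H : AbelianGroup b ℓb) where
  private G×H = abelianGroup G H

  proj₁-ℕmul : ∀ k x → proj₁ (ℕmul G×H k x) ≡ ℕmul G k (proj₁ x)
  proj₁-ℕmul zero    x = ≡.refl
  proj₁-ℕmul (suc k) x = cong (AbelianGroup._∙_ G (proj₁ x)) (proj₁-ℕmul k x)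

  proj₁-ℤmul : ∀ c x → proj₁ (ℤmul G×H c x) ≡ ℤmul G c (proj₁ x)
  proj₁-ℤmul (+ k)    x = proj₁-ℕmul k x
  proj₁-ℤmul -[1+ k ] x = cong (AbelianGroup._⁻¹ G) (proj₁-ℕmul (suc k) x)

  proj₁-lin : ∀ {n} (e : Fin n → ℤ) s → proj₁ (lin G×H e s) ≡ lin G e (proj₁ ∘ s)
  proj₁-lin {zero}  e s = ≡.refl
  proj₁-lin {suc n} e s =
    cong₂ (AbelianGroup._∙_ G) (proj₁-ℤmul (e zero) (s zero)) (proj₁-lin (e ∘ suc) (s ∘ suc))

module _ {a ℓa b ℓb} (G₁ : FiniteAbelianGroup a ℓa) (G₂ : FiniteAbelianGroup b ℓb) {k₋ k₊ t n : ℕ}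
         (s : Fin n → AbelianGroup.Carrier (abelianGroup (FiniteAbelianGroup.group G₁) (FiniteAbelianGroup.group G₂)))
         (perfect : Perfect (abelianGroup (FiniteAbelianGroup.group G₁) (FiniteAbelianGroup.group G₂)) k₋ k₊ t s)
         where
  private
    module G₁ = FiniteAbelianGroup G₁
    module G₂ = FiniteAbelianGroup G₂
    G = abelianGroup G₁.group G₂.group
    module G = AbelianGroup G

    M = nonzeroRange k₋ k₊
    inKernel? = λ i → G₁._≟_ (proj₁ (s i)) G₁.ε
    Cₖ = coefficientsOn M inKernel?
    KernelBall = λ e → Entries Cₖ e × wt e ≤ t

    everywhere? : (i : Fin n) → Dec ⊤
    everywhere? _ = yes tt

    allVectors : List (Vector ℤ n)
    allVectors = vectors (coefficientsOn M everywhere?) t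

    covering = proj₂ perfect

    admissible : ∀ {e} → Entries Cₖ e → Adm G k₋ k₊ e
    admissible entries i =
      0⊎∈nonzeroRange⇒InM₀ k₋ k₊ (Sum.map₂ (proj₂ ∘ ∈-coefficientsOn⁻ M inKernel?) (entries i))

    π-lin≈ε : ∀ {e} → Entries Cₖ e → proj₁ (lin G e s) G₁.≈ G₁.ε
    π-lin≈ε {e} entries = G₁.trans (G₁.reflexive (proj₁-lin G₁.group G₂.group e s))
      (lin-ε G₁.group (Sum.map₂ (proj₁ ∘ ∈-coefficientsOn⁻ M inKernel?) ∘ entries))

    shift : G₁.Carrier → Vector ℤ n → G.Carrier
    shift x e = (x , G₂.ε) G.∙ lin G e s

    Φ : G₁.Carrier → Σ (Vector ℤ n) KernelBall → Vector ℤ n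
    Φ x (e , _) = proj₁ (covering (shift x e))

    Φ-injective : ∀ {x x' y y'} → Φ x y ≗ Φ x' y' → x G₁.≈ x' × proj₁ y ≗ proj₁ y'
    Φ-injective {x} {x'} {e , entries , w} {e' , entries' , w'} Φ≗ =
      x≈x' , lin-injective G (proj₁ perfect) (admissible entries) (admissible entries') w w' lin≈
      where
      covers : ∀ g → lin G (proj₁ (covering g)) s G.≈ g
      covers g = proj₂ (proj₂ (proj₂ (covering g)))
      shift≈ : shift x e G.≈ shift x' e'
      shift≈ = G.trans (G.sym (covers (shift x e))) (G.trans (lin-cong G s Φ≗) (covers (shift x' e')))
      x≈x' : x G₁.≈ x'
      x≈x' = begin
        x                          ≈⟨ G₁.identityʳ x ⟨
        x G₁.∙ G₁.ε                ≈⟨ G₁.∙-congˡ (π-lin≈ε entries) ⟨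
        x G₁.∙ proj₁ (lin G e s)   ≈⟨ proj₁ shift≈ ⟩
        x' G₁.∙ proj₁ (lin G e' s) ≈⟨ G₁.∙-congˡ (π-lin≈ε entries') ⟩
        x' G₁.∙ G₁.ε               ≈⟨ G₁.identityʳ x' ⟩
        x'                         ∎
        where open import Relation.Binary.Reasoning.Setoid G₁.setoid
      lin≈ : lin G e s G.≈ lin G e' s
      lin≈ = ∙-cancelˡ (x' , G₂.ε) _ _ (G.trans (G.∙-congʳ (G₁.sym x≈x' , G₂.refl)) shift≈)
        where open GroupProperties G.group using (∙-cancelˡ)

    kernelVectors : List (Σ (Vector ℤ n) KernelBall)
    kernelVectors = All.toList (vectors-sound Cₖ t)

    map-proj₁-kernelVectors : map proj₁ kernelVectors ≡ vectors Cₖ t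
    map-proj₁-kernelVectors = map-proj₁-toList (vectors-sound Cₖ t)

    kernelVectors-unique : Unique (On.setoid (Vectorₛ n) proj₁) kernelVectors
    kernelVectors-unique = Unique.map⁻ (On.setoid (Vectorₛ n) proj₁) (Vectorₛ n) (λ e≗e' → e≗e')
      (≡.subst (Unique (Vectorₛ n)) (≡.sym map-proj₁-kernelVectors)
        (vectors-unique Cₖ
          (coefficientsOn-preserves M inKernel? Propositional.Unique (nonzeroRange-unique k₋ k₊) [])
          (coefficientsOn-preserves M inKernel? (0ℤ ∉_) (0∉nonzeroRange k₋ k₊) (λ ()))
          t))

    length-kernelVectors : length kernelVectors ≡ ballSize (k₋ + k₊) (count inKernel?) t
    length-kernelVectors = begin
      length kernelVectors                    ≡⟨ length-map proj₁ kernelVectors ⟨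
      length (map proj₁ kernelVectors)        ≡⟨ cong length map-proj₁-kernelVectors ⟩
      length (vectors Cₖ t)                   ≡⟨ length-vectors M inKernel? t ⟩
      ballSize (length M) (count inKernel?) t ≡⟨ cong (λ K → ballSize K (count inKernel?) t) (length-nonzeroRange k₋ k₊) ⟩
      ballSize (k₋ + k₊) (count inKernel?) t  ∎
      where open ≡.≡-Reasoning

    length-allVectors : length allVectors ≡ ballSize (k₋ + k₊) n t
    length-allVectors = ≡.trans (length-vectors M everywhere? t)
      (cong₂ (λ K m → ballSize K m t) (length-nonzeroRange k₋ k₊) (count-all everywhere? _))

    covering-∈ : ∀ g → proj₁ (covering g) ∈ᵥ allVectors
    covering-∈ g = let e , adm , w , _ = covering g in
      vectors-complete _ e (InM₀⇒0⊎∈nonzeroRange k₋ k₊ ∘ adm) w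

  card*ballSize≤ballSize : G₁.card * ballSize (k₋ + k₊) (count inKernel?) t ≤ ballSize (k₋ + k₊) n t
  card*ballSize≤ballSize = begin
    G₁.card * ballSize (k₋ + k₊) (count inKernel?) t       ≡⟨ cong (G₁.card *_) length-kernelVectors ⟨
    length G₁.elems * length kernelVectors                 ≡⟨ length-cartesianProductWith Φ G₁.elems kernelVectors ⟨
    length (cartesianProductWith Φ G₁.elems kernelVectors) ≤⟨ unique⇒length≤ (Vectorₛ n) Φ-unique Φ-∈ ⟩
    length allVectors                                      ≡⟨ length-allVectors ⟩
    ballSize (k₋ + k₊) n t                                 ∎
    where
    open ≤-Reasoning
    -- Φ does not determine its arguments, so the implicit arguments of Φ-injective are passed explicitly.
    Φ-unique = Unique.cartesianProductWith⁺ G₁.setoid (On.setoid (Vectorₛ n) proj₁) (Vectorₛ n) Φ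
      (λ {x} {x'} {y} {y'} → Φ-injective {x} {x'} {y} {y'}) G₁.distinct kernelVectors-unique
    Φ-∈ = All.cartesianProductWith⁺ G₁.setoid (On.setoid (Vectorₛ n) proj₁) Φ G₁.elems kernelVectors
      (λ _ _ → covering-∈ _)

lemma7 : ∀ {a ℓa b ℓb : Level} (G₁ : FiniteAbelianGroup a ℓa) (G₂ : FiniteAbelianGroup b ℓb)
           (k₋ k₊ n : ℕ) → k₋ ≤ k₊ →
           (s : Fin n → AbelianGroup.Carrier (abelianGroup (FiniteAbelianGroup.group G₁) (FiniteAbelianGroup.group G₂))) →
           Perfect (abelianGroup (FiniteAbelianGroup.group G₁) (FiniteAbelianGroup.group G₂)) k₋ k₊ 2 s →
           let S₁ = count (λ i → ¬? (FiniteAbelianGroup._≟_ G₁ (proj₁ (s i)) (FiniteAbelianGroup.ε G₁)))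
           in n ≤ S₁ + 1 ⊎ ((n ∸ (S₁ + 1)) ^ 2) * FiniteAbelianGroup.card G₁ < n ^ 2
-- The bound holds without k₋ ≤ k₊.
lemma7 G₁ G₂ k₋ k₊ n _ s perfect =
  ballSize-radius2-bound-∸ (k₋ + k₊) (FiniteAbelianGroup.card G₁) (count inKernel?) _ n
    (count-complement inKernel?) (card*ballSize≤ballSize G₁ G₂ s perfect)
  where
  inKernel? = λ i → FiniteAbelianGroup._≟_ G₁ (proj₁ (s i)) (FiniteAbelianGroup.ε G₁)
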